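{- Let $n$ be an integer with $n\ge 3$ and let $r\in\{1,2,\ldots,\lfloor \frac n2\rfloor-1\}$. Then the complement $\overline{C_n^{(r)}}$ of the $r$-th power of the cycle of length $n$ is not an open XOR-magic graph.
   Context: For $n\ge 3$ and $S\subseteq\{1,\ldots,\lfloor n/2\rfloor\}$, the circulant graph $C_n(S)$ has vertices $x_0,\ldots,x_{n-1}$, with distinct $x_i,x_j$ adjacent iff $|i-j|\in\{s,\,n-s: s\in S\}$. The $r$-th power of the cycle of length $n$ is $C_n^{(r)}=C_n(\{1,2,\ldots,r\})$; its complement is $C_n(\{r+1,\ldots,\lfloor n/2\rfloor\})$. For a vertex $x$, $N(x)$ is its set of neighbours. A simple connected graph $G=(V,E)$ is an open XOR-magic graph if $|V|=2^p$ for some positive integer $p$ and there is a bijection $\ell:V\to(\mathbb{Z}_2)^p$ with $\sum_{y\in N(x)}\ell(y)=0$ in $(\mathbb{Z}_2)^p$ for every $x\in V$. -}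

module Defs where

open import Data.Nat using (ℕ; zero; suc; _+_; _∸_; _≤_; _<_; _/_; _^_)
open import Data.Nat.Properties using (_≤?_; _≟_)
open import Data.Bool using (Bool; true; false; _∧_; _∨_; not; _xor_; if_then_else_)
open import Data.Fin using (Fin; toℕ)
import Data.Fin as F
open import Data.Vec using (Vec; replicate; zipWith)
open import Data.List using (List; []; _∷_)
open import Data.Product using (Σ; _×_; _,_; ∃-syntax)
open import Function.Bundles using (Bijection)
open import Relation.Binary.PropositionalEquality using (_≡_; setoid)
open import Relation.Nullary.Decidable using (⌊_⌋)

Graph : ℕ → Set
Graph n = Fin n → Fin n → Bool

absDiff : ℕ → ℕ → ℕ
absDiff a b = (a ∸ b) + (b ∸ a)

-- Circulant graph C_n(S), with S ⊆ {1,…,⌊n/2⌋} given as a decidable (Boolean)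
-- predicate on ℕ: distinct x_i, x_j adjacent iff |i-j| ∈ {s, n-s : s ∈ S}.
circulant : (n : ℕ) → (ℕ → Bool) → Graph n
circulant n S i j =
  not ⌊ toℕ i ≟ toℕ j ⌋ ∧ (S d ∨ S (n ∸ d))
  where d = absDiff (toℕ i) (toℕ j)

inUpTo : ℕ → ℕ → Bool
inUpTo r s = ⌊ 1 ≤? s ⌋ ∧ ⌊ s ≤? r ⌋

cyclePower : (n r : ℕ) → Graph n
cyclePower n r = circulant n (inUpTo r)

complement : ∀ {n} → Graph n → Graph n
complement G i j = not ⌊ toℕ i ≟ toℕ j ⌋ ∧ not (G i j)

data Walk {n : ℕ} (G : Graph n) : Fin n → Fin n → Set where
  here : ∀ {x} → Walk G x x
  step : ∀ {x y z} → G x y ≡ true → Walk G y z → Walk G x z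

Connected : ∀ {n} → Graph n → Set
Connected {n} G = (x y : Fin n) → Walk G x y

Z2^ : ℕ → Set
Z2^ p = Vec Bool p

zeroV : (p : ℕ) → Z2^ p
zeroV p = replicate p false

_⊕_ : ∀ {p} → Z2^ p → Z2^ p → Z2^ p
_⊕_ = zipWith _xor_

sumWhere : ∀ {n p} → (Fin n → Bool) → (Fin n → Z2^ p) → Z2^ p
sumWhere {zero}  {p} P f = zeroV p
sumWhere {suc n} {p} P f =
  (if P F.zero then f F.zero else zeroV p) ⊕ sumWhere (λ i → P (F.suc i)) (λ i → f (F.suc i))

OpenXORMagic : ∀ {n} → Graph n → Set
OpenXORMagic {n} G =
  Connected G ×
  Σ ℕ λ p → (1 ≤ p) × (n ≡ 2 ^ p) ×
    Σ (Bijection (setoid (Fin n)) (setoid (Z2^ p))) λ ℓ →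
      (x : Fin n) → sumWhere (G x) (Bijection.to ℓ) ≡ zeroV p

{-# OPTIONS --safe #-}
-- In the complement of C_n^(r), a vertex c together with its non-neighbours forms the arc c − r, …, c + r.
-- As 2r + 1 < n, for c = r and c = r + 1 these arcs are 0, …, 2r and 1, …, 2r + 1 without wrap-around,
-- so the neighbourhoods of r and r + 1 differ exactly in the vertices 0 and 2r + 1. Adding their two
-- vanishing label sums in (ℤ₂)^p gives ℓ(0) + ℓ(2r + 1) = 0, i.e. ℓ(0) = ℓ(2r + 1), contradicting the
-- injectivity of ℓ.

module Submission where

open import Algebra.Bundles using (CommutativeRing)
open import Data.Bool using (Bool; true; false; not; _∧_; _∨_; _xor_; if_then_else_)
open import Data.Bool.Properties
  using (xor-∧-commutativeRing; xor-identityˡ; xor-identityʳ; xor-assoc; xor-comm; xor-same;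
         not-involutive; ∧-zeroʳ; ∨-identityʳ)
open import Algebra.Properties.CommutativeSemigroup
  (CommutativeRing.+-commutativeSemigroup xor-∧-commutativeRing)
  using () renaming (interchange to xor-interchange)
open import Data.Fin using (Fin; zero; suc; toℕ; fromℕ<)
open import Data.Fin.Properties using (toℕ<n; toℕ-injective; toℕ-fromℕ<) renaming (_≟_ to _≟ᶠ_)
open import Data.Nat using (ℕ; zero; suc; _+_; _*_; _∸_; _≤_; _<_; _/_; ∣_-_∣; z≤n; s≤s; s≤s⁻¹)
open import Data.Nat.DivMod using (m/n*n≤m)
open import Data.Nat.Properties
open import Data.Nat.Tactic.RingSolver using (solve-∀)
open import Data.Product using (_,_)
open import Data.Sum using (inj₁; inj₂)
open import Data.Vec using ([]; _∷_)
open import Data.Vec.Properties using (zipWith-identityˡ; zipWith-identityʳ; zipWith-assoc)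
open import Function using (_∘_)
open import Function.Bundles using (Bijection; mk⇔)
open import Relation.Binary.PropositionalEquality
open import Relation.Nullary using (¬_; yes; no)
open import Relation.Nullary.Decidable using (does; isYes≗does; does-⇔; dec-true; dec-false)

open import Defs

⊕-identityˡ : ∀ {p} (v : Z2^ p) → zeroV p ⊕ v ≡ v
⊕-identityˡ = zipWith-identityˡ xor-identityˡ

⊕-identityʳ : ∀ {p} (v : Z2^ p) → v ⊕ zeroV p ≡ v
⊕-identityʳ = zipWith-identityʳ xor-identityʳ

⊕-assoc : ∀ {p} (u v w : Z2^ p) → (u ⊕ v) ⊕ w ≡ u ⊕ (v ⊕ w)
⊕-assoc = zipWith-assoc xor-assoc

⊕-self : ∀ {p} (v : Z2^ p) → v ⊕ v ≡ zeroV p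
⊕-self []      = refl
⊕-self (b ∷ v) = cong₂ _∷_ (xor-same b) (⊕-self v)

⊕-interchange : ∀ {p} (u v w x : Z2^ p) → (u ⊕ v) ⊕ (w ⊕ x) ≡ (u ⊕ w) ⊕ (v ⊕ x)
⊕-interchange []      []      []      []      = refl
⊕-interchange (a ∷ u) (b ∷ v) (c ∷ w) (d ∷ x) =
  cong₂ _∷_ (xor-interchange a b c d) (⊕-interchange u v w x)

⊕≡zero⇒≡ : ∀ {p} {u v : Z2^ p} → u ⊕ v ≡ zeroV p → u ≡ v
⊕≡zero⇒≡ {p} {u} {v} u⊕v≡0 = begin
  u            ≡⟨ ⊕-identityʳ u ⟨
  u ⊕ zeroV p  ≡⟨ cong (u ⊕_) (⊕-self v) ⟨
  u ⊕ (v ⊕ v)  ≡⟨ ⊕-assoc u v v ⟨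
  (u ⊕ v) ⊕ v  ≡⟨ cong (_⊕ v) u⊕v≡0 ⟩
  zeroV p ⊕ v  ≡⟨ ⊕-identityˡ v ⟩
  v            ∎
  where open ≡-Reasoning

if-⊕-if : ∀ {p} (b c : Bool) (v : Z2^ p) →
          (if b then v else zeroV p) ⊕ (if c then v else zeroV p) ≡ (if b xor c then v else zeroV p)
if-⊕-if true  true  v = ⊕-self v
if-⊕-if true  false v = ⊕-identityʳ v
if-⊕-if false true  v = ⊕-identityˡ v
if-⊕-if false false v = ⊕-self (zeroV _)

sumWhere-cong : ∀ {n p} {P Q : Fin n → Bool} (f : Fin n → Z2^ p) →
                (∀ y → P y ≡ Q y) → sumWhere P f ≡ sumWhere Q f
sumWhere-cong {zero}  f P≗Q = refl
sumWhere-cong {suc n} f P≗Q =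
  cong₂ _⊕_ (cong (λ b → if b then f zero else zeroV _) (P≗Q zero))
            (sumWhere-cong (f ∘ suc) (P≗Q ∘ suc))

sumWhere-xor : ∀ {n p} (P Q : Fin n → Bool) (f : Fin n → Z2^ p) →
               sumWhere P f ⊕ sumWhere Q f ≡ sumWhere (λ y → P y xor Q y) f
sumWhere-xor {zero}  P Q f = ⊕-self (zeroV _)
sumWhere-xor {suc n} P Q f = trans (⊕-interchange _ _ _ _)
  (cong₂ _⊕_ (if-⊕-if (P zero) (Q zero) (f zero)) (sumWhere-xor (P ∘ suc) (Q ∘ suc) (f ∘ suc)))

sumWhere-false : ∀ {n p} (f : Fin n → Z2^ p) → sumWhere (λ _ → false) f ≡ zeroV p
sumWhere-false {zero}  f = refl
sumWhere-false {suc n} f = trans (⊕-identityˡ _) (sumWhere-false (f ∘ suc))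

sumWhere-≟ : ∀ {n p} (f : Fin n → Z2^ p) (a : Fin n) → sumWhere (λ y → does (y ≟ᶠ a)) f ≡ f a
sumWhere-≟ f zero    = trans (cong (f zero ⊕_) (sumWhere-false (f ∘ suc))) (⊕-identityʳ (f zero))
sumWhere-≟ f (suc a) = trans (⊕-identityˡ _) (sumWhere-≟ (f ∘ suc) a)

ZeroSumLabelling : ∀ {n p} → Graph n → (Fin n → Z2^ p) → Set
ZeroSumLabelling {p = p} G ℓ = ∀ x → sumWhere (G x) ℓ ≡ zeroV p

zeroSum-label-≡ : ∀ {n p} {G : Graph n} {ℓ : Fin n → Z2^ p} → ZeroSumLabelling G ℓ →
                  ∀ x x′ {a b} → (∀ y → G x y xor G x′ y ≡ does (y ≟ᶠ a) xor does (y ≟ᶠ b)) → ℓ a ≡ ℓ b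
zeroSum-label-≡ {p = p} {G} {ℓ} zero-sums x x′ {a} {b} N[x]ΔN[x′]≡[a,b] = ⊕≡zero⇒≡ (begin
  ℓ a ⊕ ℓ b
    ≡⟨ cong₂ _⊕_ (sumWhere-≟ ℓ a) (sumWhere-≟ ℓ b) ⟨
  sumWhere (λ y → does (y ≟ᶠ a)) ℓ ⊕ sumWhere (λ y → does (y ≟ᶠ b)) ℓ
    ≡⟨ sumWhere-xor _ _ ℓ ⟩
  sumWhere (λ y → does (y ≟ᶠ a) xor does (y ≟ᶠ b)) ℓ
    ≡⟨ sumWhere-cong ℓ N[x]ΔN[x′]≡[a,b] ⟨
  sumWhere (λ y → G x y xor G x′ y) ℓ
    ≡⟨ sumWhere-xor (G x) (G x′) ℓ ⟨
  sumWhere (G x) ℓ ⊕ sumWhere (G x′) ℓ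
    ≡⟨ cong₂ _⊕_ (zero-sums x) (zero-sums x′) ⟩
  zeroV p ⊕ zeroV p
    ≡⟨ ⊕-self (zeroV p) ⟩
  zeroV p ∎)
  where open ≡-Reasoning

absDiff≡∣-∣ : ∀ m n → absDiff m n ≡ ∣ m - n ∣
absDiff≡∣-∣ zero    zero    = refl
absDiff≡∣-∣ zero    (suc n) = refl
absDiff≡∣-∣ (suc m) zero    = +-identityʳ (suc m)
absDiff≡∣-∣ (suc m) (suc n) = absDiff≡∣-∣ m n

o+∣m-n∣<p : ∀ {m n o p} → o ≤ m → m + o < p → n < p → o + ∣ m - n ∣ < p
o+∣m-n∣<p {m} {n} {o} {p} o≤m m+o<p n<p with ≤-total m n
... | inj₁ m≤n = begin-strict
  o + ∣ m - n ∣  ≡⟨ cong (o +_) (m≤n⇒∣m-n∣≡n∸m m≤n) ⟩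
  o + (n ∸ m)    ≤⟨ +-monoˡ-≤ (n ∸ m) o≤m ⟩
  m + (n ∸ m)    ≡⟨ m+[n∸m]≡n m≤n ⟩
  n              <⟨ n<p ⟩
  p              ∎
  where open ≤-Reasoning
... | inj₂ n≤m = begin-strict
  o + ∣ m - n ∣  ≡⟨ cong (o +_) (m≤n⇒∣n-m∣≡n∸m n≤m) ⟩
  o + (m ∸ n)    ≤⟨ +-monoʳ-≤ o (m∸n≤m m n) ⟩
  o + m          ≡⟨ +-comm o m ⟩
  m + o          <⟨ m+o<p ⟩
  p              ∎
  where open ≤-Reasoning

-- The cyclic distance of x and y is the minimum of d = ∣ toℕ x - toℕ y ∣ and n ∸ d; the bound makes it d.
complement-cyclePower-noWrap : ∀ {n} r (x y : Fin n) → r + ∣ toℕ x - toℕ y ∣ < n →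
                               complement (cyclePower n r) x y ≡ not (does (∣ toℕ x - toℕ y ∣ ≤? r))
complement-cyclePower-noWrap {n} r x y r+d<n rewrite absDiff≡∣-∣ (toℕ x) (toℕ y) with toℕ x ≟ toℕ y
... | yes x≡y rewrite x≡y | ∣n-n∣≡0 (toℕ y) = refl
... | no x≢y = cong not (trans
  (cong₂ _∨_ (cong₂ _∧_ (trans (isYes≗does (1 ≤? d)) (dec-true (1 ≤? d) 0<d)) (isYes≗does (d ≤? r)))
             (trans (cong (_ ∧_) (trans (isYes≗does (n ∸ d ≤? r)) (dec-false (n ∸ d ≤? r) n∸d≰r)))
                    (∧-zeroʳ _)))
  (∨-identityʳ _))
  where
  d = ∣ toℕ x - toℕ y ∣
  0<d : 0 < d
  0<d = n≢0⇒n>0 (x≢y ∘ ∣m-n∣≡0⇒m≡n)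
  n∸d≰r : ¬ (n ∸ d ≤ r)
  n∸d≰r = <⇒≱ (m+n≤o⇒m≤o∸n (suc r) r+d<n)

≤?-suc : ∀ m n → does (suc m ≤? suc n) ≡ does (m ≤? n)
≤?-suc m n = does-⇔ (mk⇔ s≤s⁻¹ s≤s) (suc m ≤? suc n) (m ≤? n)

≟-suc : ∀ m n → does (suc m ≟ suc n) ≡ does (m ≟ n)
≟-suc m n = does-⇔ (mk⇔ suc-injective (cong suc)) (suc m ≟ suc n) (m ≟ n)

≤?-xor-<? : ∀ m n → does (m ≤? n) xor does (m <? n) ≡ does (m ≟ n)
≤?-xor-<? zero    zero    = refl
≤?-xor-<? zero    (suc n) = refl
≤?-xor-<? (suc m) zero    = refl
≤?-xor-<? (suc m) (suc n) =
  trans (cong₂ _xor_ (≤?-suc m n) (≤?-suc (suc m) n)) (trans (≤?-xor-<? m n) (sym (≟-suc m n)))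

∣m-n∣≤?o-xor-∣1+m-n∣≤?o : ∀ m n o → does (∣ m - n ∣ ≤? o) xor does (∣ suc m - n ∣ ≤? o) ≡
                                  does (m ≟ n + o) xor does (n ≟ suc (m + o))
∣m-n∣≤?o-xor-∣1+m-n∣≤?o zero    zero    o = trans (≤?-xor-<? 0 o) (sym (xor-identityʳ _))
∣m-n∣≤?o-xor-∣1+m-n∣≤?o zero    (suc n) o =
  trans (xor-comm (does (n <? o)) (does (n ≤? o))) (trans (≤?-xor-<? n o) (sym (≟-suc n o)))
∣m-n∣≤?o-xor-∣1+m-n∣≤?o (suc m) zero    o = trans (≤?-xor-<? (suc m) o) (sym (xor-identityʳ _))
∣m-n∣≤?o-xor-∣1+m-n∣≤?o (suc m) (suc n) o =
  trans (∣m-n∣≤?o-xor-∣1+m-n∣≤?o m n o) (sym (cong₂ _xor_ (≟-suc m (n + o)) (≟-suc n (suc (m + o)))))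

not-xor-not : ∀ a b → not a xor not b ≡ a xor b
not-xor-not true  b = refl
not-xor-not false b = not-involutive b

complement-cyclePower-consecutive-Δ : ∀ {n r} {a x x′ b : Fin n} →
                                      toℕ x ≡ toℕ a + r → toℕ x′ ≡ suc (toℕ x) → toℕ b ≡ toℕ x′ + r → ∀ y →
                                      complement (cyclePower n r) x y xor complement (cyclePower n r) x′ y ≡
                                      does (y ≟ᶠ a) xor does (y ≟ᶠ b)
complement-cyclePower-consecutive-Δ {n} {r} {a} {x} {x′} {b} x≡a+r x′≡1+x b≡x′+r y = begin
  G x y xor G x′ y
    ≡⟨ cong₂ _xor_ (complement-cyclePower-noWrap r x y (o+∣m-n∣<p r≤x x+r<n (toℕ<n y)))
                   (complement-cyclePower-noWrap r x′ y (o+∣m-n∣<p r≤x′ x′+r<n (toℕ<n y))) ⟩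
  not (does (∣ toℕ x - z ∣ ≤? r)) xor not (does (∣ toℕ x′ - z ∣ ≤? r))
    ≡⟨ not-xor-not (does (∣ toℕ x - z ∣ ≤? r)) (does (∣ toℕ x′ - z ∣ ≤? r)) ⟩
  does (∣ toℕ x - z ∣ ≤? r) xor does (∣ toℕ x′ - z ∣ ≤? r)
    ≡⟨ cong (λ c → does (∣ toℕ x - z ∣ ≤? r) xor does (∣ c - z ∣ ≤? r)) x′≡1+x ⟩
  does (∣ toℕ x - z ∣ ≤? r) xor does (∣ suc (toℕ x) - z ∣ ≤? r)
    ≡⟨ ∣m-n∣≤?o-xor-∣1+m-n∣≤?o (toℕ x) z r ⟩
  does (toℕ x ≟ z + r) xor does (z ≟ suc (toℕ x + r))
    ≡⟨ cong₂ _xor_ left-end right-end ⟩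
  does (y ≟ᶠ a) xor does (y ≟ᶠ b) ∎
  where
  open ≡-Reasoning
  G = complement (cyclePower n r)
  z = toℕ y
  r≤x : r ≤ toℕ x
  r≤x = subst (r ≤_) (sym x≡a+r) (m≤n+m r (toℕ a))
  r≤x′ : r ≤ toℕ x′
  r≤x′ = ≤-trans r≤x (subst (toℕ x ≤_) (sym x′≡1+x) (n≤1+n (toℕ x)))
  x′+r<n : toℕ x′ + r < n
  x′+r<n = subst (_< n) b≡x′+r (toℕ<n b)
  x+r<n : toℕ x + r < n
  x+r<n = <⇒≤ (subst (λ c → c + r < n) x′≡1+x x′+r<n)
  left-end : does (toℕ x ≟ z + r) ≡ does (y ≟ᶠ a)
  left-end = does-⇔ (mk⇔ (λ x≡z+r → toℕ-injective (+-cancelʳ-≡ r z (toℕ a) (trans (sym x≡z+r) x≡a+r)))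
                         (λ y≡a → trans x≡a+r (cong (λ v → toℕ v + r) (sym y≡a))))
                    (toℕ x ≟ z + r) (y ≟ᶠ a)
  b≡1+x+r : toℕ b ≡ suc (toℕ x + r)
  b≡1+x+r = trans b≡x′+r (cong (_+ r) x′≡1+x)
  right-end : does (z ≟ suc (toℕ x + r)) ≡ does (y ≟ᶠ b)
  right-end = does-⇔ (mk⇔ (λ y≡1+x+r → toℕ-injective (trans y≡1+x+r (sym b≡1+x+r)))
                          (λ y≡b → trans (cong toℕ y≡b) b≡1+x+r))
                     (z ≟ suc (toℕ x + r)) (y ≟ᶠ b)

r+1≤n/2⇒2r+1<n : ∀ {n} r → r + 1 ≤ n / 2 → suc (r + r) < n
r+1≤n/2⇒2r+1<n {n} r r+1≤n/2 = begin
  suc (suc (r + r))  ≡⟨ 2+2r≡[r+1]*2 r ⟩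
  (r + 1) * 2        ≤⟨ *-monoˡ-≤ 2 r+1≤n/2 ⟩
  n / 2 * 2          ≤⟨ m/n*n≤m n 2 ⟩
  n                  ∎
  where
  open ≤-Reasoning
  2+2r≡[r+1]*2 : ∀ r → suc (suc (r + r)) ≡ (r + 1) * 2
  2+2r≡[r+1]*2 = solve-∀

module InitialSegment {n : ℕ} (r : ℕ) (2r+1<n : suc (r + r) < n) where

  vertex : ∀ k → k ≤ suc (r + r) → Fin n
  vertex k k≤2r+1 = fromℕ< (≤-<-trans k≤2r+1 2r+1<n)

  toℕ-vertex : ∀ {k} (k≤2r+1 : k ≤ suc (r + r)) → toℕ (vertex k k≤2r+1) ≡ k
  toℕ-vertex k≤2r+1 = toℕ-fromℕ< _

  zeroSum-complement-cyclePower : ∀ {p} {ℓ : Fin n → Z2^ p} →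
                                  ZeroSumLabelling (complement (cyclePower n r)) ℓ →
                                  ℓ (vertex 0 z≤n) ≡ ℓ (vertex (suc (r + r)) ≤-refl)
  zeroSum-complement-cyclePower zero-sums =
    zeroSum-label-≡ zero-sums (vertex r r≤2r+1) (vertex (suc r) 1+r≤2r+1)
      (complement-cyclePower-consecutive-Δ
        (trans (toℕ-vertex r≤2r+1) (cong (_+ r) (sym (toℕ-vertex z≤n))))
        (trans (toℕ-vertex 1+r≤2r+1) (cong suc (sym (toℕ-vertex r≤2r+1))))
        (trans (toℕ-vertex ≤-refl) (cong (_+ r) (sym (toℕ-vertex 1+r≤2r+1)))))
    where
    r≤2r+1 : r ≤ suc (r + r)
    r≤2r+1 = ≤-trans (m≤m+n r r) (n≤1+n _)
    1+r≤2r+1 : suc r ≤ suc (r + r)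
    1+r≤2r+1 = s≤s (m≤m+n r r)

corollary3 : (n r : ℕ) → 3 ≤ n → 1 ≤ r → r + 1 ≤ n / 2 → ¬ OpenXORMagic (complement (cyclePower n r))
corollary3 n r _ _ r+1≤n/2 (_ , _ , _ , _ , ℓ , zero-sums) = 0≢1+n (begin
  0                                 ≡⟨ toℕ-vertex z≤n ⟨
  toℕ (vertex 0 z≤n)                ≡⟨ cong toℕ (injective (zeroSum-complement-cyclePower zero-sums)) ⟩
  toℕ (vertex (suc (r + r)) ≤-refl) ≡⟨ toℕ-vertex ≤-refl ⟩
  suc (r + r)                       ∎)
  where
  open ≡-Reasoning
  open Bijection ℓ using (injective)
  open InitialSegment r (r+1≤n/2⇒2r+1<n {n} r r+1≤n/2)
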